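{- Consider the following random coloring of a graph $G$ that is a disjoint union of paths: independently for each path, choose an endpoint and color the path vertex by vertex starting from that endpoint, giving the first vertex a uniformly random color from a palette of $6$ colors and each subsequent vertex a uniformly random color from the palette different from the color of the previous vertex. Let $x,y$ be two distinct non-adjacent vertices of $G$. Then for any fixed assignment of colors to all vertices other than $x$ and $y$ (occurring with positive probability), conditioned on it, the probability that $x$ and $y$ receive the same color is at least $1/8$.
   Context: In this coloring scheme the color of a vertex serves as its label, and two labels are decoded as adjacent iff the colors are different. -}

module Defs where

open import Data.Nat using (ℕ; zero; suc)
import Data.Fin
open Data.Fin using (Fin; toℕ; opposite)
open import Data.Fin.Properties using () renaming (_≟_ to _≟ᶠ_)
open import Data.Bool using (Bool; true; false)
open import Data.List using (List; []; _∷_; tabulate)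
open import Data.Product using (Σ; _,_; _×_; proj₁; proj₂)
open import Data.Product.Properties using (≡-dec)
open import Data.Sum using (_⊎_)
open import Data.Integer using (+_)
open import Data.Rational using (ℚ; _/_; _*_; _+_; 0ℚ; 1ℚ)
open import Relation.Binary.PropositionalEquality using (_≡_)
open import Relation.Nullary using (Dec; yes; no)

Colour : Set
Colour = Fin 6

-- A disjoint union of k paths; path i has (suc (len i)) vertices,
-- vertex (i , j) is the j-th vertex along path i.
Vertex : {k : ℕ} → (Fin k → ℕ) → Set
Vertex {k} len = Σ (Fin k) (λ i → Fin (suc (len i)))

Adj : {k : ℕ} {len : Fin k → ℕ} → Vertex len → Vertex len → Set
Adj (i , j) (i' , j') = i ≡ i' × (suc (toℕ j) ≡ toℕ j' ⊎ suc (toℕ j') ≡ toℕ j)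

Colouring : {k : ℕ} → (Fin k → ℕ) → Set
Colouring len = Vertex len → Colour

_≟ᵛ_ : {k : ℕ} {len : Fin k → ℕ} → (u v : Vertex len) → Dec (u ≡ v)
_≟ᵛ_ = ≡-dec _≟ᶠ_ _≟ᶠ_

-- Probability that, after the previous vertex received colour a, the
-- remaining vertices (in order) receive the listed colours: each next
-- vertex gets a uniform colour among the 5 colours different from the
-- previous one.
stepProb : Colour → List Colour → ℚ
stepProb a [] = 1ℚ
stepProb a (b ∷ cs) with a ≟ᶠ b
... | yes _ = 0ℚ
... | no  _ = (+ 1 / 5) * stepProb b cs

-- Probability that colouring a path vertex by vertex (in the listed order)
-- produces exactly the listed colours: first colour uniform among 6.
seqProb : List Colour → ℚ
seqProb [] = 1ℚ
seqProb (a ∷ cs) = (+ 1 / 6) * stepProb a cs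

-- Colours of path i read from the chosen starting endpoint:
-- false = start at vertex 0, true = start at the last vertex.
pathColours : {k : ℕ} (len : Fin k → ℕ) → (Fin k → Bool) →
              Colouring len → Fin k → List Colour
pathColours len dir c i with dir i
... | false = tabulate (λ j → c (i , j))
... | true  = tabulate (λ j → c (i , opposite j))

prodFin : (k : ℕ) → (Fin k → ℚ) → ℚ
prodFin zero f = 1ℚ
prodFin (suc k) f = f Data.Fin.zero * prodFin k (λ i → f (Data.Fin.suc i))

sumFin : (k : ℕ) → (Fin k → ℚ) → ℚ
sumFin zero f = 0ℚ
sumFin (suc k) f = f Data.Fin.zero + sumFin k (λ i → f (Data.Fin.suc i))

colProb : {k : ℕ} (len : Fin k → ℕ) → (Fin k → Bool) → Colouring len → ℚ
colProb {k} len dir c = prodFin k (λ i → seqProb (pathColours len dir c i))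

update2 : {k : ℕ} {len : Fin k → ℕ} → Colouring len → Vertex len → Vertex len →
          Colour → Colour → Colouring len
update2 τ x y a b v with v ≟ᵛ x
... | yes _ = a
... | no _ with v ≟ᵛ y
...   | yes _ = b
...   | no _  = τ v

-- P(colouring agrees with τ on all vertices other than x, y)
probAgree : {k : ℕ} (len : Fin k → ℕ) → (Fin k → Bool) →
            Colouring len → Vertex len → Vertex len → ℚ
probAgree len dir τ x y =
  sumFin 6 (λ a → sumFin 6 (λ b → colProb len dir (update2 τ x y a b)))

-- P(colouring agrees with τ off {x, y}  and  x, y get the same colour)
probAgreeSame : {k : ℕ} (len : Fin k → ℕ) → (Fin k → Bool) →
                Colouring len → Vertex len → Vertex len → ℚ
probAgreeSame len dir τ x y =
  sumFin 6 (λ a → colProb len dir (update2 τ x y a a))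

-- A colouring has probability 0 if it is improper and otherwise the same weight
-- ∏ᵢ (1/6)(1/5)^(len i), whatever the starting endpoints. So, conditioned on the
-- colours off {x, y}, the pair (colour x, colour y) is uniform on A × B, where A
-- (resp. B) is the set of colours differing from those of the at most two
-- neighbours of x (resp. y). As |A|, |B| ≥ 4, we get |A ∩ B| ≥ |A| + |B| − 6 ≥ |A||B|/8.
module Submission where

open import Defs
open import Data.Nat using (ℕ; zero; suc)
open import Data.Nat.Properties using (suc-injective; 1+n≢n)
open import Data.Fin using (Fin; toℕ; inject₁; opposite) renaming (zero to fzero; suc to fsuc)
open import Data.Fin.Properties using (all?; toℕ-inject₁; toℕ-injective; opposite-involutive)
  renaming (_≟_ to _≟ᶠ_)
open import Data.Bool using (Bool; true; false; not; _∧_)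
open import Data.Maybe using (Maybe; just; nothing)
import Data.Maybe as Maybe
open import Data.Maybe.Properties using (just-injective)
open import Data.List using (tabulate)
open import Data.Product using (Σ; _,_; _×_)
open import Data.Sum using (_⊎_; inj₁; inj₂)
open import Data.Integer using (+_)
open import Data.Rational using (ℚ; _/_; _*_; _+_; _≤_; _<_; 0ℚ; 1ℚ; NonNegative)
import Data.Rational.Properties as ℚ
open import Function using (_∘_)
open import Level using (0ℓ)
open import Relation.Binary.PropositionalEquality
open import Relation.Nullary using (¬_; Dec; does; yes; no; contradiction)
open import Relation.Nullary.Decidable using (map′; _×-dec_; toWitness)
open import Relation.Unary using (Pred; Decidable)

sumFin-cong : ∀ k {f g : Fin k → ℚ} → (∀ i → f i ≡ g i) → sumFin k f ≡ sumFin k g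
sumFin-cong zero    f≗g = refl
sumFin-cong (suc k) f≗g = cong₂ _+_ (f≗g fzero) (sumFin-cong k (f≗g ∘ fsuc))

sumFin-zero : ∀ k → sumFin k (λ _ → 0ℚ) ≡ 0ℚ
sumFin-zero zero    = refl
sumFin-zero (suc k) = cong (_+_ 0ℚ) (sumFin-zero k)

sumFin-*ˡ : ∀ k w (f : Fin k → ℚ) → sumFin k (λ i → w * f i) ≡ w * sumFin k f
sumFin-*ˡ zero    w f = sym (ℚ.*-zeroʳ w)
sumFin-*ˡ (suc k) w f =
  trans (cong (_+_ (w * f fzero)) (sumFin-*ˡ k w (f ∘ fsuc)))
        (sym (ℚ.*-distribˡ-+ w (f fzero) _))

prodFin-cong : ∀ k {f g : Fin k → ℚ} → (∀ i → f i ≡ g i) → prodFin k f ≡ prodFin k g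
prodFin-cong zero    f≗g = refl
prodFin-cong (suc k) f≗g = cong₂ _*_ (f≗g fzero) (prodFin-cong k (f≗g ∘ fsuc))

prodFin-zero : ∀ k (f : Fin k → ℚ) i → f i ≡ 0ℚ → prodFin k f ≡ 0ℚ
prodFin-zero (suc k) f fzero    fi≡0 =
  trans (cong (_* prodFin k (f ∘ fsuc)) fi≡0) (ℚ.*-zeroˡ (prodFin k (f ∘ fsuc)))
prodFin-zero (suc k) f (fsuc i) fi≡0 =
  trans (cong (f fzero *_) (prodFin-zero k (f ∘ fsuc) i fi≡0)) (ℚ.*-zeroʳ (f fzero))

prodFin-nonNeg : ∀ k (f : Fin k → ℚ) → (∀ i → NonNegative (f i)) → NonNegative (prodFin k f)
prodFin-nonNeg zero    f nonNeg = _
prodFin-nonNeg (suc k) f nonNeg =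
  ℚ.nonNeg*nonNeg⇒nonNeg (f fzero) {{nonNeg fzero}}
                         (prodFin k (f ∘ fsuc)) {{prodFin-nonNeg k (f ∘ fsuc) (nonNeg ∘ fsuc)}}

fifthPower : ℕ → ℚ
fifthPower zero    = 1ℚ
fifthPower (suc n) = + 1 / 5 * fifthPower n

fifthPower-nonNeg : ∀ n → NonNegative (fifthPower n)
fifthPower-nonNeg zero    = _
fifthPower-nonNeg (suc n) = ℚ.nonNeg*nonNeg⇒nonNeg (+ 1 / 5) (fifthPower n) {{fifthPower-nonNeg n}}

pathWeight : ℕ → ℚ
pathWeight n = + 1 / 6 * fifthPower n

pathWeight-nonNeg : ∀ n → NonNegative (pathWeight n)
pathWeight-nonNeg n = ℚ.nonNeg*nonNeg⇒nonNeg (+ 1 / 6) (fifthPower n) {{fifthPower-nonNeg n}}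

IsProperPath : ∀ {n} → (Fin (suc n) → Colour) → Set
IsProperPath {n} g = ∀ (j : Fin n) → g (inject₁ j) ≢ g (fsuc j)

stepProb-proper : ∀ n (g : Fin (suc n) → Colour) → IsProperPath g →
                  stepProb (g fzero) (tabulate (g ∘ fsuc)) ≡ fifthPower n
stepProb-proper zero    g proper = refl
stepProb-proper (suc n) g proper with g fzero ≟ᶠ g (fsuc fzero)
... | yes clash = contradiction clash (proper fzero)
... | no _      = cong (+ 1 / 5 *_) (stepProb-proper n (g ∘ fsuc) (proper ∘ fsuc))

stepProb-clash : ∀ n (g : Fin (suc n) → Colour) (j : Fin n) → g (inject₁ j) ≡ g (fsuc j) →
                 stepProb (g fzero) (tabulate (g ∘ fsuc)) ≡ 0ℚ
stepProb-clash (suc n) g j clash with g fzero ≟ᶠ g (fsuc fzero)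
stepProb-clash (suc n) g j        clash | yes _  = refl
stepProb-clash (suc n) g fzero    clash | no ¬eq = contradiction clash ¬eq
stepProb-clash (suc n) g (fsuc j) clash | no _   =
  trans (cong (+ 1 / 5 *_) (stepProb-clash n (g ∘ fsuc) j clash)) (ℚ.*-zeroʳ (+ 1 / 5))

seqProb-proper : ∀ {n} (g : Fin (suc n) → Colour) → IsProperPath g →
                 seqProb (tabulate g) ≡ pathWeight n
seqProb-proper g proper = cong (+ 1 / 6 *_) (stepProb-proper _ g proper)

seqProb-clash : ∀ {n} (g : Fin (suc n) → Colour) (j : Fin n) → g (inject₁ j) ≡ g (fsuc j) →
                seqProb (tabulate g) ≡ 0ℚ
seqProb-clash g j clash = trans (cong (+ 1 / 6 *_) (stepProb-clash _ g j clash)) (ℚ.*-zeroʳ (+ 1 / 6))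

opposite-inject₁ : ∀ {n} (j : Fin n) → opposite (inject₁ j) ≡ fsuc (opposite j)
opposite-inject₁ fzero    = refl
opposite-inject₁ (fsuc j) = cong inject₁ (opposite-inject₁ j)

IsProperPath-opposite : ∀ {n} (g : Fin (suc n) → Colour) → IsProperPath g → IsProperPath (g ∘ opposite)
IsProperPath-opposite g proper j clash =
  proper (opposite j) (sym (trans (cong g (sym (opposite-inject₁ j))) clash))

clash-opposite : ∀ {n} (g : Fin (suc n) → Colour) (j : Fin n) → g (inject₁ j) ≡ g (fsuc j) →
                g (opposite (inject₁ (opposite j))) ≡ g (opposite (fsuc (opposite j)))
clash-opposite g j clash = begin
  g (opposite (inject₁ (opposite j))) ≡⟨ cong g (opposite-inject₁ (opposite j)) ⟩
  g (fsuc (opposite (opposite j)))    ≡⟨ cong (g ∘ fsuc) (opposite-involutive j) ⟩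
  g (fsuc j)                          ≡⟨ sym clash ⟩
  g (inject₁ j)                       ≡⟨ cong (g ∘ inject₁) (opposite-involutive j) ⟨
  g (inject₁ (opposite (opposite j))) ∎
  where open ≡-Reasoning

consecutive⇒edge : ∀ {n} (p q : Fin (suc n)) → suc (toℕ p) ≡ toℕ q →
                   Σ (Fin n) λ j → p ≡ inject₁ j × q ≡ fsuc j
consecutive⇒edge p (fsuc j) p+1≡q =
  j , toℕ-injective (trans (suc-injective p+1≡q) (sym (toℕ-inject₁ j))) , refl

module _ {k : ℕ} (len : Fin k → ℕ) where

  Proper : Colouring len → Set
  Proper c = ∀ u v → Adj u v → c u ≢ c v

  ProperAt : Colouring len → Vertex len → Set
  ProperAt c z = ∀ v → Adj z v → c z ≢ c v

  adj-sym : ∀ {u v : Vertex len} → Adj u v → Adj v u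
  adj-sym (refl , inj₁ s) = refl , inj₂ s
  adj-sym (refl , inj₂ s) = refl , inj₁ s

  adj-irrefl : ∀ {u : Vertex len} → ¬ Adj u u
  adj-irrefl (refl , inj₁ s) = 1+n≢n s
  adj-irrefl (refl , inj₂ s) = 1+n≢n s

  edge-adj : ∀ i (j : Fin (len i)) → Adj {len = len} (i , inject₁ j) (i , fsuc j)
  edge-adj i j = refl , inj₁ (cong suc (toℕ-inject₁ j))

  seqProb-pathColours-proper : ∀ dir c i → IsProperPath (λ j → c (i , j)) →
                               seqProb (pathColours len dir c i) ≡ pathWeight (len i)
  seqProb-pathColours-proper dir c i proper with dir i
  ... | false = seqProb-proper (λ j → c (i , j)) proper
  ... | true  = seqProb-proper (λ j → c (i , opposite j)) (IsProperPath-opposite (λ j → c (i , j)) proper)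

  seqProb-pathColours-clash : ∀ dir c i (j : Fin (len i)) → c (i , inject₁ j) ≡ c (i , fsuc j) →
                              seqProb (pathColours len dir c i) ≡ 0ℚ
  seqProb-pathColours-clash dir c i j clash with dir i
  ... | false = seqProb-clash (λ j → c (i , j)) j clash
  ... | true  = seqProb-clash (λ j → c (i , opposite j)) (opposite j)
                              (clash-opposite (λ j → c (i , j)) j clash)

  weight : ℚ
  weight = prodFin k (pathWeight ∘ len)

  weight-nonNeg : NonNegative weight
  weight-nonNeg = prodFin-nonNeg k (pathWeight ∘ len) (pathWeight-nonNeg ∘ len)

  colProb-proper : ∀ dir c → Proper c → colProb len dir c ≡ weight
  colProb-proper dir c proper = prodFin-cong k λ i →
    seqProb-pathColours-proper dir c i (λ j → proper _ _ (edge-adj i j))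

  colProb-clash : ∀ dir c {u v} → Adj u v → c u ≡ c v → colProb len dir c ≡ 0ℚ
  colProb-clash dir c {i , p} {_ , q} (refl , inj₁ p+1≡q) clash with consecutive⇒edge p q p+1≡q
  ... | j , refl , refl = prodFin-zero k _ i (seqProb-pathColours-clash dir c i j clash)
  colProb-clash dir c (refl , inj₂ q+1≡p) clash = colProb-clash dir c (refl , inj₁ q+1≡p) (sym clash)

predecessor : ∀ {n} → Fin (suc n) → Maybe (Fin (suc n))
predecessor fzero    = nothing
predecessor (fsuc j) = just (inject₁ j)

successor : ∀ {n} → Fin (suc n) → Maybe (Fin (suc n))
successor {zero}  fzero    = nothing
successor {suc n} fzero    = just (fsuc fzero)
successor {suc n} (fsuc j) = Maybe.map fsuc (successor j)

successor-inject₁ : ∀ {n} (j : Fin n) → successor (inject₁ j) ≡ just (fsuc j)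
successor-inject₁ {suc n} fzero    = refl
successor-inject₁ {suc n} (fsuc j) = cong (Maybe.map fsuc) (successor-inject₁ j)

predecessor⇒consecutive : ∀ {n} (j p : Fin (suc n)) → predecessor j ≡ just p → suc (toℕ p) ≡ toℕ j
predecessor⇒consecutive (fsuc j) _ refl = cong suc (toℕ-inject₁ j)

successor⇒consecutive : ∀ {n} (j q : Fin (suc n)) → successor j ≡ just q → suc (toℕ j) ≡ toℕ q
successor⇒consecutive {suc n} fzero    _ refl = refl
successor⇒consecutive {suc n} (fsuc j) q eq with successor j in succ-j
successor⇒consecutive {suc n} (fsuc j) _ refl | just q = cong suc (successor⇒consecutive j q succ-j)

differs : Maybe Colour → Colour → Bool
differs nothing  a = true
differs (just c) a = not (does (a ≟ᶠ c))

avoids : Maybe Colour → Maybe Colour → Colour → Bool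
avoids l r a = differs l a ∧ differs r a

differs-false : ∀ m a → differs m a ≡ false → m ≡ just a
differs-false (just c) a eq with a ≟ᶠ c
differs-false (just c) a eq | yes a≡c = cong just (sym a≡c)
differs-false (just c) a () | no _

differs-true : ∀ c a → differs (just c) a ≡ true → a ≢ c
differs-true c a eq with a ≟ᶠ c
differs-true c a () | yes _
differs-true c a eq | no a≢c = a≢c

avoids-false : ∀ l r a → avoids l r a ≡ false → l ≡ just a ⊎ r ≡ just a
avoids-false l r a eq with differs l a in differs-l
... | false = inj₁ (differs-false l a differs-l)
... | true  = inj₂ (differs-false r a eq)

avoids-true : ∀ l r a {c} → avoids l r a ≡ true → l ≡ just c ⊎ r ≡ just c → a ≢ c
avoids-true (just c) r a eq (inj₁ refl) with differs (just c) a in differs-l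
... | true = differs-true c a differs-l
avoids-true l (just c) a eq (inj₂ refl) with differs l a
... | true = differs-true c a eq

indicator : Bool → ℚ
indicator true  = 1ℚ
indicator false = 0ℚ

all-Maybe? : ∀ {A : Set} {P : Pred (Maybe A) 0ℓ} →
             Dec (P nothing) → Dec (∀ a → P (just a)) → Dec (∀ m → P m)
all-Maybe? p? q? =
  map′ (λ { (p , q) nothing → p ; (p , q) (just a) → q a }) (λ h → h nothing , h ∘ just) (p? ×-dec q?)

all-Maybe-Fin? : ∀ {n} {P : Pred (Maybe (Fin n)) 0ℓ} → Decidable P → Dec (∀ m → P m)
all-Maybe-Fin? P? = all-Maybe? (P? nothing) (all? (P? ∘ just))

-- Decided by evaluation over all 7⁴ possible neighbour colours of x and y.
countingBound : ∀ l r l' r' →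
  + 1 / 8 * sumFin 6 (λ a → sumFin 6 (λ b → indicator (avoids l r a ∧ avoids l' r' b)))
    ≤ sumFin 6 (λ a → indicator (avoids l r a ∧ avoids l' r' a))
countingBound = toWitness {a? = all-Maybe-Fin? λ l → all-Maybe-Fin? λ r →
                                all-Maybe-Fin? λ l' → all-Maybe-Fin? λ r' → _ ℚ.≤? _} _

scaledCountingBound : ∀ w → .{{NonNegative w}} → ∀ l r l' r' →
  + 1 / 8 * sumFin 6 (λ a → sumFin 6 (λ b → w * indicator (avoids l r a ∧ avoids l' r' b)))
    ≤ sumFin 6 (λ a → w * indicator (avoids l r a ∧ avoids l' r' a))
scaledCountingBound w l r l' r' = begin
  + 1 / 8 * sumFin 6 (λ a → sumFin 6 (λ b → w * pairs a b)) ≡⟨ cong (+ 1 / 8 *_) factor ⟩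
  + 1 / 8 * (w * allPairs)                                   ≡⟨ swap ⟩
  w * (+ 1 / 8 * allPairs)                                   ≤⟨ ℚ.*-monoˡ-≤-nonNeg w (countingBound l r l' r') ⟩
  w * sumFin 6 (λ a → pairs a a)                             ≡⟨ sumFin-*ˡ 6 w (λ a → pairs a a) ⟨
  sumFin 6 (λ a → w * pairs a a)                             ∎
  where
  open ℚ.≤-Reasoning
  pairs : Colour → Colour → ℚ
  pairs a b = indicator (avoids l r a ∧ avoids l' r' b)
  allPairs : ℚ
  allPairs = sumFin 6 (λ a → sumFin 6 (pairs a))
  factor : sumFin 6 (λ a → sumFin 6 (λ b → w * pairs a b)) ≡ w * allPairs
  factor = trans (sumFin-cong 6 (λ a → sumFin-*ˡ 6 w (pairs a))) (sumFin-*ˡ 6 w (λ a → sumFin 6 (pairs a)))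
  swap : + 1 / 8 * (w * allPairs) ≡ w * (+ 1 / 8 * allPairs)
  swap = trans (sym (ℚ.*-assoc (+ 1 / 8) w allPairs))
               (trans (cong (_* allPairs) (ℚ.*-comm (+ 1 / 8) w)) (ℚ.*-assoc w (+ 1 / 8) allPairs))

module _ {k : ℕ} {len : Fin k → ℕ} (τ : Colouring len) where

  precedingColour followingColour : Vertex len → Maybe Colour
  precedingColour (i , j) = Maybe.map (λ p → τ (i , p)) (predecessor j)
  followingColour (i , j) = Maybe.map (λ q → τ (i , q)) (successor j)

  allowed : Vertex len → Colour → Bool
  allowed z = avoids (precedingColour z) (followingColour z)

  adj⇒neighbourColour : ∀ {z v} → Adj z v → precedingColour z ≡ just (τ v) ⊎ followingColour z ≡ just (τ v)
  adj⇒neighbourColour {i , j} {_ , q} (refl , inj₁ j+1≡q) with consecutive⇒edge j q j+1≡q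
  ... | j' , refl , refl = inj₂ (cong (Maybe.map (λ q → τ (i , q))) (successor-inject₁ j'))
  adj⇒neighbourColour {i , j} {_ , p} (refl , inj₂ p+1≡j) with consecutive⇒edge p j p+1≡j
  ... | j' , refl , refl = inj₁ refl

  allowed-false : ∀ z a → allowed z a ≡ false → Σ (Vertex len) λ v → Adj z v × τ v ≡ a
  allowed-false (i , j) a eq with avoids-false (precedingColour (i , j)) (followingColour (i , j)) a eq
  ... | inj₁ preceding with predecessor j in pred-j
  ...   | just p = (i , p) , (refl , inj₂ (predecessor⇒consecutive j p pred-j)) , just-injective preceding
  allowed-false (i , j) a eq | inj₂ following with successor j in succ-j
  ...   | just q = (i , q) , (refl , inj₁ (successor⇒consecutive j q succ-j)) , just-injective following

  allowed-true : ∀ z a {v} → allowed z a ≡ true → Adj z v → a ≢ τ v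
  allowed-true z a eq z∼v = avoids-true (precedingColour z) (followingColour z) a eq (adj⇒neighbourColour z∼v)

module _ {k : ℕ} {len : Fin k → ℕ} (x y : Vertex len) where

  Outside : Vertex len → Set
  Outside u = u ≢ x × u ≢ y

  ProperOutside : Colouring len → Set
  ProperOutside c = ∀ u v → Adj u v → Outside u → Outside v → c u ≢ c v

  proper-from-x-y-outside : ∀ c → ProperAt len c x → ProperAt len c y → ProperOutside c → Proper len c
  proper-from-x-y-outside c at-x at-y outside u v u∼v with u ≟ᵛ x | u ≟ᵛ y | v ≟ᵛ x | v ≟ᵛ y
  ... | yes refl | _        | _        | _        = at-x v u∼v
  ... | no _     | yes refl | _        | _        = at-y v u∼v
  ... | no _     | no _     | yes refl | _        = ≢-sym (at-x u (adj-sym len u∼v))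
  ... | no _     | no _     | no _     | yes refl = ≢-sym (at-y u (adj-sym len u∼v))
  ... | no u≢x   | no u≢y   | no v≢x   | no v≢y   = outside u v u∼v (u≢x , u≢y) (v≢x , v≢y)

  module _ (τ : Colouring len) (a b : Colour) where

    update2-x : update2 τ x y a b x ≡ a
    update2-x with x ≟ᵛ x
    ... | yes _   = refl
    ... | no x≢x = contradiction refl x≢x

    update2-y : x ≢ y → update2 τ x y a b y ≡ b
    update2-y x≢y with y ≟ᵛ x
    ... | yes y≡x = contradiction (sym y≡x) x≢y
    ... | no _ with y ≟ᵛ y
    ...   | yes _   = refl
    ...   | no y≢y = contradiction refl y≢y

    update2-outside : ∀ {u} → Outside u → update2 τ x y a b u ≡ τ u
    update2-outside {u} (u≢x , u≢y) with u ≟ᵛ x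
    ... | yes u≡x = contradiction u≡x u≢x
    ... | no _ with u ≟ᵛ y
    ...   | yes u≡y = contradiction u≡y u≢y
    ...   | no _    = refl

    properOutside-update2 : ProperOutside τ → ProperOutside (update2 τ x y a b)
    properOutside-update2 proper u v u∼v out-u out-v clash =
      proper u v u∼v out-u out-v
        (trans (sym (update2-outside out-u)) (trans clash (update2-outside out-v)))

module _ {k : ℕ} {len : Fin k → ℕ} (dir : Fin k → Bool) {x y : Vertex len}
         (x≢y : x ≢ y) (x≁y : ¬ Adj x y) (τ : Colouring len) where

  neighbour-x-outside : ∀ {v} → Adj x v → Outside x y v
  neighbour-x-outside x∼v = (λ { refl → adj-irrefl len x∼v }) , (λ { refl → x≁y x∼v })

  neighbour-y-outside : ∀ {v} → Adj y v → Outside x y v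
  neighbour-y-outside y∼v = (λ { refl → x≁y (adj-sym len y∼v) }) , (λ { refl → adj-irrefl len y∼v })

  positive⇒properOutside : 0ℚ < probAgree len dir τ x y → ProperOutside x y τ
  positive⇒properOutside positive u v u∼v out-u out-v clash =
    ℚ.<-irrefl refl (subst (0ℚ <_) probAgree≡0 positive)
    where
    update-clash : ∀ a b → colProb len dir (update2 τ x y a b) ≡ 0ℚ
    update-clash a b = colProb-clash len dir (update2 τ x y a b) u∼v
      (trans (update2-outside x y τ a b out-u) (trans clash (sym (update2-outside x y τ a b out-v))))
    probAgree≡0 : probAgree len dir τ x y ≡ 0ℚ
    probAgree≡0 = trans (sumFin-cong 6 λ a → trans (sumFin-cong 6 (update-clash a)) (sumFin-zero 6))
                        (sumFin-zero 6)

  neighbour-clash : ∀ a b {z v} → Adj z v → Outside x y v → update2 τ x y a b z ≡ τ v →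
                    colProb len dir (update2 τ x y a b) ≡ 0ℚ
  neighbour-clash a b z∼v out-v clash =
    colProb-clash len dir (update2 τ x y a b) z∼v (trans clash (sym (update2-outside x y τ a b out-v)))

  colProb-update2 : ProperOutside x y τ → ∀ a b →
    colProb len dir (update2 τ x y a b) ≡ weight len * indicator (allowed τ x a ∧ allowed τ y b)
  colProb-update2 proper a b with allowed τ x a in allowed-x | allowed τ y b in allowed-y
  ... | false | _ with allowed-false τ x a allowed-x
  ...   | v , x∼v , τv≡a =
    trans (neighbour-clash a b x∼v (neighbour-x-outside x∼v) (trans (update2-x x y τ a b) (sym τv≡a)))
          (sym (ℚ.*-zeroʳ (weight len)))
  colProb-update2 proper a b | true | false with allowed-false τ y b allowed-y
  ...   | v , y∼v , τv≡b =
    trans (neighbour-clash a b y∼v (neighbour-y-outside y∼v) (trans (update2-y x y τ a b x≢y) (sym τv≡b)))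
          (sym (ℚ.*-zeroʳ (weight len)))
  colProb-update2 proper a b | true | true =
    trans (colProb-proper len dir c (proper-from-x-y-outside x y c at-x at-y (properOutside-update2 x y τ a b proper)))
          (sym (ℚ.*-identityʳ (weight len)))
    where
    c : Colouring len
    c = update2 τ x y a b
    at-x : ProperAt len c x
    at-x v x∼v clash = allowed-true τ x a allowed-x x∼v
      (trans (sym (update2-x x y τ a b)) (trans clash (update2-outside x y τ a b (neighbour-x-outside x∼v))))
    at-y : ProperAt len c y
    at-y v y∼v clash = allowed-true τ y b allowed-y y∼v
      (trans (sym (update2-y x y τ a b x≢y)) (trans clash (update2-outside x y τ a b (neighbour-y-outside y∼v))))

claim2p1 : {k : ℕ} (len : Fin k → ℕ) (dir : Fin k → Bool)
           (x y : Vertex len) → x ≢ y → ¬ Adj x y →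
           (τ : Colouring len) →
           0ℚ < probAgree len dir τ x y →
           (+ 1 / 8) * probAgree len dir τ x y ≤ probAgreeSame len dir τ x y
claim2p1 len dir x y x≢y x≁y τ positive =
  subst₂ _≤_ (cong (+ 1 / 8 *_) (sym agree)) (sym same)
    (scaledCountingBound (weight len) {{weight-nonNeg len}}
      (precedingColour τ x) (followingColour τ x) (precedingColour τ y) (followingColour τ y))
  where
  formula : ∀ a b → colProb len dir (update2 τ x y a b) ≡ weight len * indicator (allowed τ x a ∧ allowed τ y b)
  formula = colProb-update2 dir x≢y x≁y τ (positive⇒properOutside dir x≢y x≁y τ positive)
  agree : probAgree len dir τ x y ≡
          sumFin 6 (λ a → sumFin 6 (λ b → weight len * indicator (allowed τ x a ∧ allowed τ y b)))
  agree = sumFin-cong 6 λ a → sumFin-cong 6 (formula a)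
  same : probAgreeSame len dir τ x y ≡ sumFin 6 (λ a → weight len * indicator (allowed τ x a ∧ allowed τ y a))
  same = sumFin-cong 6 λ a → formula a a
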